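{- Let $m,n\ge 2$ be integers and let $LP_{n,m}$ be a long brush graph which is $2$-distance magic with $2$-distance magic labeling $f$. Then: (i) if the induced subgraph $\langle v_1,\dots,v_m\rangle$ is the complete graph $K_m$, then $m(m-1)\le 2n$; (ii) if $\langle v_1,\dots,v_m\rangle\neq K_m$, then for all $v_i,v_j$ with $d(v_i,v_j)=2$, $1\le i<j\le m$, $$\sum_{w\in N[v_i]} f(w)=\sum_{w\in N[v_j]} f(w),$$ where $N[v]$ denotes the closed neighbourhood of $v$ in $LP_{n,m}$.
   Context: All graphs are finite, simple and undirected; $d(u,v)$ is graph distance. For $u\in V(G)$ and $k\in\mathbb{N}$, $\partial N_k(u)=\{v\in V(G): d(u,v)=k\}$. For a graph $G$ of order $p\ge3$, a $k$-distance magic labeling is a bijection $f:V(G)\to\{1,\dots,p\}$ together with a constant $M$ such that $\sum_{w\in\partial N_k(u)} f(w)=M$ for every vertex $u$ with $\partial N_k(u)\neq\emptyset$ (and $G$ has at least one pair of vertices at distance $k$). $G$ is $k$-distance magic if it has such a labeling. A long brush $LP_{n,m}$ ($m,n\in\mathbb{N}$, $m+n\ge3$) has vertex set $\{u_1,\dots,u_n,v_1,\dots,v_m\}$, with edges $u_iu_{i+1}$ ($1\le i<n$), $u_1v_i$ ($1\le i\le m$), and an arbitrary set of edges among $v_1,\dots,v_m$; $\langle v_1,\dots,v_m\rangle$ denotes the induced subgraph on $\{v_1,\dots,v_m\}$. -}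

module Defs where

open import Data.Nat using (ℕ; zero; suc; _+_)
open import Data.Fin using (Fin; toℕ)
open import Data.Fin.Properties using () renaming (_≟_ to _≟F_)
open import Data.Sum using (_⊎_; inj₁; inj₂)
open import Data.Bool using (Bool; true; false; _∧_; _∨_; not; if_then_else_)
open import Data.List using (List; map; _++_; filter)
open import Data.Nat.ListAction using (sum)
open import Data.Bool.ListAction using (any)
open import Data.List.Base using (allFin)
open import Data.Product using (Σ; ∃; _×_)
open import Relation.Nullary.Decidable using (⌊_⌋)
open import Relation.Binary.PropositionalEquality using (_≡_)
open import Function.Definitions using (Bijective)

-- Vertices of the long brush LP_{n,m}: inj₁ i is u_{i+1}, inj₂ j is v_{j+1}.
Vtx : ℕ → ℕ → Set
Vtx n m = Fin n ⊎ Fin m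

record VEdges (m : ℕ) : Set where
  field
    E     : Fin m → Fin m → Bool
    symm  : ∀ i j → E i j ≡ E j i
    irrfl : ∀ i → E i i ≡ false
open VEdges public

allV : (n m : ℕ) → List (Vtx n m)
allV n m = map inj₁ (allFin n) ++ map inj₂ (allFin m)

eqV : ∀ {n m} → Vtx n m → Vtx n m → Bool
eqV (inj₁ i) (inj₁ j) = ⌊ i ≟F j ⌋
eqV (inj₂ i) (inj₂ j) = ⌊ i ≟F j ⌋
eqV _ _ = false

consec : ℕ → ℕ → Bool
consec a b = ⌊ suc a Data.Nat.≟ b ⌋ ∨ ⌊ suc b Data.Nat.≟ a ⌋

adj : ∀ {n m} → VEdges m → Vtx n m → Vtx n m → Bool
adj G (inj₁ a) (inj₁ b) = consec (toℕ a) (toℕ b)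
adj G (inj₁ a) (inj₂ j) = ⌊ toℕ a Data.Nat.≟ 0 ⌋
adj G (inj₂ i) (inj₁ b) = ⌊ toℕ b Data.Nat.≟ 0 ⌋
adj G (inj₂ i) (inj₂ j) = E G i j

reach : ∀ {n m} → VEdges m → ℕ → Vtx n m → Vtx n m → Bool
reach {n} {m} G zero x y = eqV x y
reach {n} {m} G (suc k) x y =
  reach G k x y ∨ any (λ z → reach G k x z ∧ adj G z y) (allV n m)

distIs : ∀ {n m} → VEdges m → ℕ → Vtx n m → Vtx n m → Bool
distIs G zero x y = eqV x y
distIs G (suc k) x y = reach G (suc k) x y ∧ not (reach G k x y)

sumOver : ∀ {n m} → (Vtx n m → ℕ) → (Vtx n m → Bool) → ℕ
sumOver {n} {m} f P = sum (map f (filter (λ w → P w Data.Bool.≟ true) (allV n m)))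

label : ∀ {n m} → (Vtx n m → Fin (n + m)) → Vtx n m → ℕ
label g w = suc (toℕ (g w))

IsKDistMagicLabeling : ∀ {n m} → VEdges m → ℕ → (Vtx n m → Fin (n + m)) → Set
IsKDistMagicLabeling {n} {m} G k g =
  Bijective _≡_ _≡_ g
  × Σ (Vtx n m) (λ x → Σ (Vtx n m) (λ y → distIs G k x y ≡ true))
  × Σ ℕ (λ M → ∀ u → Σ (Vtx n m) (λ w → distIs G k u w ≡ true)
                    → sumOver (label g) (distIs G k u) ≡ M)

IsCompleteV : ∀ {m} → VEdges m → Set
IsCompleteV {m} G = ∀ (i j : Fin m) → (i ≡ j → Data.Empty.⊥) → E G i j ≡ true
  where import Data.Empty

closedNbhdSum : ∀ {n m} → VEdges m → (Vtx n m → ℕ) → Vtx n m → ℕ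
closedNbhdSum G f x = sumOver f (λ w → eqV x w ∨ adj G x w)

-- Seen from v_i, the vertex set splits into the closed neighbourhood N[v_i],
-- the vertices u_3, …, u_n (at distance at least 3) and the vertices at
-- distance exactly 2.  Hence the magic constant M satisfies
--   Σ N[v_i] + Σ {u_3, …, u_n} + M = Σ V,
-- so Σ N[v_i] does not depend on i.  If ⟨v_1, …, v_m⟩ is complete, the only
-- vertex at distance 2 from v_1 is u_2, so M is a single label and M ≤ n + m;
-- on the other hand every v_j is at distance 2 from u_2, so M is at least the
-- sum of m distinct positive labels, 1 + ⋯ + m.  Comparing gives m(m-1) ≤ 2n.

module Submission where

open import Defs
open import Data.Nat using (ℕ; zero; suc; _+_; _*_; _∸_; _≤_; _<_; z≤n; s≤s; _≟_)
open import Data.Nat.Properties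
open import Algebra.Properties.CommutativeSemigroup +-commutativeSemigroup using (x∙yz≈y∙xz)
open import Data.Nat.ListAction using (sum)
open import Data.Nat.ListAction.Properties using (sum-++)
open import Data.Nat.Tactic.RingSolver using (solve-∀)
open import Data.Fin using (Fin; toℕ; zero; suc)
open import Data.Fin.Properties using (toℕ-injective; toℕ<n) renaming (_≟_ to _≟F_)
open import Data.Sum using (_⊎_; inj₁; inj₂)
open import Data.Sum.Properties using (inj₂-injective)
open import Data.Bool using (Bool; true; false; _∨_; _∧_; not; if_then_else_)
open import Data.Bool.Properties using (∨-zeroʳ; ∧-zeroʳ)
open import Data.Bool.ListAction using (any)
open import Data.Product using (_×_; _,_; proj₁; proj₂; Σ)
open import Data.List using (List; []; _∷_; map; _++_; filter; length; tabulate; allFin)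
open import Data.List.Properties using (map-++; map-∘; length-map; length-tabulate; filter-all; filter-accept; filter-reject)
open import Data.List.Membership.Propositional using (_∈_)
open import Data.List.Membership.Propositional.Properties using (∈-map⁺; ∈-++⁺ˡ; ∈-++⁺ʳ; ∈-allFin)
open import Data.List.Relation.Unary.Any using (here; there)
open import Data.List.Relation.Unary.All as All using (All; []; _∷_)
open import Data.List.Relation.Unary.All.Properties using (all-filter; tabulate⁺)
  renaming (filter⁺ to All-filter⁺; map⁺ to All-map⁺)
open import Data.List.Relation.Unary.AllPairs using ([]; _∷_)
open import Data.List.Relation.Unary.Unique.Propositional using (Unique)
import Data.List.Relation.Unary.Unique.Propositional.Properties as Unique
open import Function using (_∘_; id)
open import Relation.Nullary using (¬_; yes; no; ¬?; contradiction)
open import Relation.Binary.PropositionalEquality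

triangle : ℕ → ℕ
triangle zero    = 0
triangle (suc k) = k + triangle k

2*triangle[k]≡k*[k∸1] : ∀ k → 2 * triangle k ≡ k * (k ∸ 1)
2*triangle[k]≡k*[k∸1] zero          = refl
2*triangle[k]≡k*[k∸1] (suc zero)    = refl
2*triangle[k]≡k*[k∸1] (suc (suc k)) = begin
  2 * (suc k + triangle (suc k))   ≡⟨ *-distribˡ-+ 2 (suc k) (triangle (suc k)) ⟩
  2 * suc k + 2 * triangle (suc k) ≡⟨ cong (2 * suc k +_) (2*triangle[k]≡k*[k∸1] (suc k)) ⟩
  2 * suc k + suc k * k            ≡⟨ expand k ⟩
  suc (suc k) * suc k              ∎
  where
  open ≡-Reasoning
  expand : ∀ k → 2 * suc k + suc k * k ≡ suc (suc k) * suc k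
  expand = solve-∀

without : ℕ → List ℕ → List ℕ
without k = filter (λ x → ¬? (x ≟ k))

without-< : ∀ {k} xs → All (_< suc k) xs → All (_< k) (without k xs)
without-< xs xs<1+k =
  All.zipWith (λ (x<1+k , x≢k) → ≤∧≢⇒< (≤-pred x<1+k) x≢k)
              (All-filter⁺ _ xs<1+k , all-filter _ xs)

length-sum-without : ∀ k {xs} → Unique xs →
    (length (without k xs) ≡ length xs × sum (without k xs) ≡ sum xs)
  ⊎ (suc (length (without k xs)) ≡ length xs × k + sum (without k xs) ≡ sum xs)
length-sum-without k {[]}     []         = inj₁ (refl , refl)
length-sum-without k {x ∷ xs} (x∉xs ∷ u) with x ≟ k
... | yes refl
  rewrite filter-reject (λ y → ¬? (y ≟ k)) {k} {xs} (λ k≢k → k≢k refl)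
        | filter-all (λ y → ¬? (y ≟ k)) (All.map (λ k≢y y≡k → k≢y (sym y≡k)) x∉xs)
  = inj₂ (refl , refl)
... | no x≢k rewrite filter-accept (λ y → ¬? (y ≟ k)) {x} {xs} x≢k with length-sum-without k u
...   | inj₁ (l , s) = inj₁ (cong suc l , cong (x +_) s)
...   | inj₂ (l , s) = inj₂ (cong suc l , trans (x∙yz≈y∙xz k x _) (cong (x +_) s))

-- Induction on the bound k; the length bound pays for the new summand in the step.
length≤∧triangle≤sum : ∀ k {xs} → Unique xs → All (_< k) xs →
  length xs ≤ k × triangle (length xs) ≤ sum xs
length≤∧triangle≤sum zero    {[]}    []  []       = z≤n , z≤n
length≤∧triangle≤sum zero    {_ ∷ _} _   (() ∷ _)
length≤∧triangle≤sum (suc k) {xs}    u   xs<1+k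
  with length≤∧triangle≤sum k (Unique.filter⁺ _ u) (without-< xs xs<1+k) | length-sum-without k u
... | l≤k , t≤s | inj₁ (l , s) rewrite sym l | sym s = m≤n⇒m≤1+n l≤k , t≤s
... | l≤k , t≤s | inj₂ (l , s) rewrite sym l | sym s = s≤s l≤k , +-mono-≤ l≤k t≤s

≤-sum : ∀ xs → All (_≤ sum xs) xs
≤-sum []       = []
≤-sum (x ∷ xs) = m≤m+n x (sum xs) ∷ All.map (λ y≤s → ≤-trans y≤s (m≤n+m (sum xs) x)) (≤-sum xs)

triangle-length≤sum : ∀ {xs} → Unique xs → triangle (length xs) ≤ sum xs
triangle-length≤sum {xs} u = proj₂ (length≤∧triangle≤sum (suc (sum xs)) u (All.map s≤s (≤-sum xs)))

sumWhere : {A : Set} → (A → ℕ) → (A → Bool) → List A → ℕ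
sumWhere f P xs = sum (map (λ w → if P w then f w else 0) xs)

module _ {A : Set} (f : A → ℕ) where

  sum-map-filter : ∀ P xs → sum (map f (filter (λ w → P w Data.Bool.≟ true) xs)) ≡ sumWhere f P xs
  sum-map-filter P []       = refl
  sum-map-filter P (x ∷ xs) with P x
  ... | true  = cong (f x +_) (sum-map-filter P xs)
  ... | false = sum-map-filter P xs

  sumWhere-cong : ∀ {P Q} xs → (∀ w → P w ≡ Q w) → sumWhere f P xs ≡ sumWhere f Q xs
  sumWhere-cong []       P≗Q = refl
  sumWhere-cong (x ∷ xs) P≗Q rewrite P≗Q x = cong (_ +_) (sumWhere-cong xs P≗Q)

  sumWhere-∨ : ∀ P Q xs → (∀ w → (P w ∧ Q w) ≡ false) →
    sumWhere f (λ w → P w ∨ Q w) xs ≡ sumWhere f P xs + sumWhere f Q xs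
  sumWhere-∨ P Q []       disjoint = refl
  sumWhere-∨ P Q (x ∷ xs) disjoint with P x in Px | Q x in Qx
  ... | true  | true  = contradiction (trans (sym (cong₂ _∧_ Px Qx)) (disjoint x)) λ ()
  ... | true  | false = trans (cong (f x +_) (sumWhere-∨ P Q xs disjoint)) (sym (+-assoc (f x) _ _))
  ... | false | true  = trans (cong (f x +_) (sumWhere-∨ P Q xs disjoint))
                               (x∙yz≈y∙xz (f x) (sumWhere f P xs) (sumWhere f Q xs))
  ... | false | false = sumWhere-∨ P Q xs disjoint

  sumWhere-+-sumWhere-not : ∀ P xs → sumWhere f P xs + sumWhere f (not ∘ P) xs ≡ sum (map f xs)
  sumWhere-+-sumWhere-not P []       = refl
  sumWhere-+-sumWhere-not P (x ∷ xs) with P x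
  ... | true  = trans (+-assoc (f x) _ _) (cong (f x +_) (sumWhere-+-sumWhere-not P xs))
  ... | false = trans (x∙yz≈y∙xz (sumWhere f P xs) (f x) _)
                      (cong (f x +_) (sumWhere-+-sumWhere-not P xs))

  sumWhere-mono : ∀ {P Q} xs → (∀ w → P w ≡ true → Q w ≡ true) → sumWhere f P xs ≤ sumWhere f Q xs
  sumWhere-mono         []       P⇒Q = z≤n
  sumWhere-mono {P} {Q} (x ∷ xs) P⇒Q with P x in Px
  ... | true  rewrite P⇒Q x Px = +-monoʳ-≤ (f x) (sumWhere-mono xs P⇒Q)
  ... | false = ≤-trans (sumWhere-mono xs P⇒Q) (m≤n+m _ _)

sum-map-zero : ∀ {A : Set} {h : A → ℕ} {xs} → All (λ x → h x ≡ 0) xs → sum (map h xs) ≡ 0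
sum-map-zero []          = refl
sum-map-zero (hx≡0 ∷ hs) rewrite hx≡0 = sum-map-zero hs

sum-allV : ∀ {n m} (h : Vtx n m → ℕ) →
  sum (map h (allV n m)) ≡ sum (map (h ∘ inj₁) (allFin n)) + sum (map (h ∘ inj₂) (allFin m))
sum-allV {n} {m} h = begin
  sum (map h (map inj₁ (allFin n) ++ map inj₂ (allFin m)))
    ≡⟨ cong sum (map-++ h (map inj₁ (allFin n)) _) ⟩
  sum (map h (map inj₁ (allFin n)) ++ map h (map inj₂ (allFin m)))
    ≡⟨ sum-++ (map h (map inj₁ (allFin n))) _ ⟩
  sum (map h (map inj₁ (allFin n))) + sum (map h (map inj₂ (allFin m)))
    ≡⟨ sym (cong₂ _+_ (cong sum (map-∘ (allFin n))) (cong sum (map-∘ (allFin m)))) ⟩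
  sum (map (h ∘ inj₁) (allFin n)) + sum (map (h ∘ inj₂) (allFin m)) ∎
  where open ≡-Reasoning

any-true : ∀ {A : Set} (p : A → Bool) {z} xs → z ∈ xs → p z ≡ true → any p xs ≡ true
any-true p (x ∷ xs) (here refl) pz rewrite pz = refl
any-true p (x ∷ xs) (there z∈) pz rewrite any-true p xs z∈ pz = ∨-zeroʳ (p x)

any-false : ∀ {A : Set} (p : A → Bool) xs → (∀ z → p z ≡ false) → any p xs ≡ false
any-false p []       p≗false = refl
any-false p (x ∷ xs) p≗false rewrite p≗false x = any-false p xs p≗false

∈-allV : ∀ {n m} (v : Vtx n m) → v ∈ allV n m
∈-allV {n} (inj₁ a) = ∈-++⁺ˡ (∈-map⁺ inj₁ (∈-allFin a))
∈-allV {n} (inj₂ b) = ∈-++⁺ʳ (map inj₁ (allFin n)) (∈-map⁺ inj₂ (∈-allFin b))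

eqV-refl : ∀ {n m} (x : Vtx n m) → eqV x x ≡ true
eqV-refl (inj₁ i) with i ≟F i
... | yes _  = refl
... | no i≢i = contradiction refl i≢i
eqV-refl (inj₂ i) with i ≟F i
... | yes _  = refl
... | no i≢i = contradiction refl i≢i

eqV-sound : ∀ {n m} {x z : Vtx n m} → eqV x z ≡ true → x ≡ z
eqV-sound {x = inj₁ i} {inj₁ j} e  with i ≟F j
eqV-sound {x = inj₁ i} {inj₁ j} e  | yes refl = refl
eqV-sound {x = inj₁ i} {inj₁ j} () | no _
eqV-sound {x = inj₂ i} {inj₂ j} e  with i ≟F j
eqV-sound {x = inj₂ i} {inj₂ j} e  | yes refl = refl
eqV-sound {x = inj₂ i} {inj₂ j} () | no _

closedNbhd : ∀ {n m} → VEdges m → Vtx n m → Vtx n m → Bool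
closedNbhd G x w = eqV x w ∨ adj G x w

reach-1 : ∀ {n m} (G : VEdges m) (x y : Vtx n m) → reach G 1 x y ≡ closedNbhd G x y
reach-1 {n} {m} G x y = cong (eqV x y ∨_) via-neighbour
  where
  via-neighbour : any (λ z → eqV x z ∧ adj G z y) (allV n m) ≡ adj G x y
  via-neighbour with adj G x y in xy
  ... | true  = any-true _ (allV n m) (∈-allV x) (trans (cong (_∧ adj G x y) (eqV-refl x)) xy)
  ... | false = any-false _ (allV n m) not-via
    where
    not-via : ∀ z → (eqV x z ∧ adj G z y) ≡ false
    not-via z with eqV x z in xz
    ... | false = refl
    ... | true with eqV-sound {x = x} {z} xz
    ...   | refl = xy

twoSteps : ∀ {n m} → VEdges m → Vtx n m → Vtx n m → Bool
twoSteps {n} {m} G x w = any (λ z → reach G 1 x z ∧ adj G z w) (allV n m)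

distIs-2 : ∀ {n m} (G : VEdges m) (x w : Vtx n m) →
  distIs G 2 x w ≡ (closedNbhd G x w ∨ twoSteps G x w) ∧ not (closedNbhd G x w)
distIs-2 G x w rewrite reach-1 G x w = refl

twoSteps-via-u₁ : ∀ {n m} (G : VEdges m) (i : Fin m) (w : Vtx (suc n) m) →
  adj G (inj₁ zero) w ≡ true → twoSteps G (inj₂ i) w ≡ true
twoSteps-via-u₁ {n} {m} G i w u₁w = any-true _ (allV (suc n) m) (∈-allV (inj₁ zero))
  (trans (cong (_∧ adj G (inj₁ zero) w) (reach-1 {suc n} G (inj₂ i) (inj₁ zero))) u₁w)

-- The vertices u_3, …, u_n, at distance at least 3 from every v_i.
distant : ∀ {n m} → Vtx n m → Bool
distant (inj₁ (suc (suc _))) = true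
distant _                    = false

twoSteps-distant : ∀ {n m} (G : VEdges m) (i : Fin m) (w : Vtx n m) →
  distant w ≡ true → twoSteps G (inj₂ i) w ≡ false
twoSteps-distant {n} {m} G i (inj₁ (suc (suc c))) _ = any-false _ (allV n m) not-via
  where
  not-via : ∀ z → (reach G 1 (inj₂ i) z ∧ adj G z (inj₁ (suc (suc c)))) ≡ false
  not-via z rewrite reach-1 G (inj₂ i) z with z
  ... | inj₁ zero    = refl
  ... | inj₁ (suc _) = refl
  ... | inj₂ _       = ∧-zeroʳ _

distIs-2-from-v : ∀ {n m} (G : VEdges m) (i : Fin m) (w : Vtx (suc n) m) →
  distIs G 2 (inj₂ i) w ≡ not (closedNbhd G (inj₂ i) w ∨ distant w)
distIs-2-from-v {n} G i (inj₁ zero) = distIs-2 {suc n} G (inj₂ i) (inj₁ zero)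
distIs-2-from-v {n} G i w@(inj₁ (suc zero)) =
  trans (distIs-2 {suc n} G (inj₂ i) w) (cong (_∧ true) (twoSteps-via-u₁ G i w refl))
distIs-2-from-v {n} G i w@(inj₁ (suc (suc _))) =
  trans (distIs-2 {suc n} G (inj₂ i) w) (cong (_∧ true) (twoSteps-distant G i w refl))
distIs-2-from-v {n} G i w@(inj₂ j) =
  trans (distIs-2 {suc n} G (inj₂ i) w)
        (via-u₁ (closedNbhd G (inj₂ i) w) (twoSteps-via-u₁ G i w refl))
  where
  via-u₁ : ∀ c {t} → t ≡ true → (c ∨ t) ∧ not c ≡ not (c ∨ false)
  via-u₁ true  _    = refl
  via-u₁ false t≡tt = cong (_∧ true) t≡tt

closedNbhd-distant-disjoint : ∀ {n m} (G : VEdges m) (i : Fin m) (w : Vtx n m) →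
  (closedNbhd G (inj₂ i) w ∧ distant w) ≡ false
closedNbhd-distant-disjoint G i (inj₁ (suc (suc _))) = refl
closedNbhd-distant-disjoint G i w@(inj₁ zero)       = ∧-zeroʳ (closedNbhd G (inj₂ i) w)
closedNbhd-distant-disjoint G i w@(inj₁ (suc zero))  = ∧-zeroʳ (closedNbhd G (inj₂ i) w)
closedNbhd-distant-disjoint G i w@(inj₂ _)           = ∧-zeroʳ (closedNbhd G (inj₂ i) w)

closedNbhdSum+distant+sphere₂ : ∀ {n m} (G : VEdges m) (f : Vtx (suc n) m → ℕ) (i : Fin m) →
  closedNbhdSum G f (inj₂ i) + sumWhere f distant (allV (suc n) m) + sumOver f (distIs G 2 (inj₂ i))
    ≡ sum (map f (allV (suc n) m))
closedNbhdSum+distant+sphere₂ {n} {m} G f i = begin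
  sumOver f N[vᵢ] + sumWhere f distant V + sumOver f (distIs G 2 (inj₂ i))
    ≡⟨ cong₂ (λ a b → a + sumWhere f distant V + b)
         (sum-map-filter f N[vᵢ] V) (sum-map-filter f (distIs G 2 (inj₂ i)) V) ⟩
  sumWhere f N[vᵢ] V + sumWhere f distant V + sumWhere f (distIs G 2 (inj₂ i)) V
    ≡⟨ cong₂ _+_ (sym (sumWhere-∨ f N[vᵢ] distant V (closedNbhd-distant-disjoint G i)))
                 (sumWhere-cong f V (distIs-2-from-v G i)) ⟩
  sumWhere f near V + sumWhere f (not ∘ near) V
    ≡⟨ sumWhere-+-sumWhere-not f near V ⟩
  sum (map f V) ∎
  where
  open ≡-Reasoning
  V = allV (suc n) m
  N[vᵢ] = closedNbhd G (inj₂ i)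
  near : Vtx (suc n) m → Bool
  near w = N[vᵢ] w ∨ distant w

distIs-2-u₂-v : ∀ {n m} (G : VEdges m) (j : Fin m) →
  distIs {suc (suc n)} G 2 (inj₁ (suc zero)) (inj₂ j) ≡ true
distIs-2-u₂-v {n} {m} G j =
  trans (distIs-2 {suc (suc n)} G (inj₁ (suc zero)) (inj₂ j)) (cong (_∧ true) via-u₁)
  where
  via-u₁ : twoSteps {suc (suc n)} G (inj₁ (suc zero)) (inj₂ j) ≡ true
  via-u₁ = any-true (λ z → reach G 1 (inj₁ (suc zero)) z ∧ adj G z (inj₂ j))
             (allV (suc (suc n)) m) (∈-allV (inj₁ zero))
             (cong (_∧ true) (reach-1 {suc (suc n)} G (inj₁ (suc zero)) (inj₁ zero)))

closedNbhd-complete : ∀ {n m} (G : VEdges m) → IsCompleteV G →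
  ∀ i j → closedNbhd {n} G (inj₂ i) (inj₂ j) ≡ true
closedNbhd-complete G K i j with i ≟F j
... | yes refl = refl
... | no i≢j   = K i j i≢j

isU₂ : ∀ {n m} → Vtx n m → Bool
isU₂ (inj₁ (suc zero)) = true
isU₂ _                 = false

isV : ∀ {n m} → Vtx n m → Bool
isV (inj₁ _) = false
isV (inj₂ _) = true

distIs-2-from-v-complete : ∀ {n m} (G : VEdges m) → IsCompleteV G →
  (i : Fin m) (w : Vtx (suc n) m) → distIs G 2 (inj₂ i) w ≡ isU₂ w
distIs-2-from-v-complete {n} G K i w = trans (distIs-2-from-v G i w) (only-u₂ w)
  where
  only-u₂ : ∀ w → not (closedNbhd G (inj₂ i) w ∨ distant w) ≡ isU₂ w
  only-u₂ (inj₁ zero)          = refl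
  only-u₂ (inj₁ (suc zero))    = refl
  only-u₂ (inj₁ (suc (suc _))) = refl
  only-u₂ (inj₂ j) rewrite closedNbhd-complete {suc n} G K i j = refl

sumWhere-isU₂ : ∀ {n m} (f : Vtx (suc (suc n)) m → ℕ) →
  sumWhere f isU₂ (allV (suc (suc n)) m) ≡ f (inj₁ (suc zero))
sumWhere-isU₂ {n} {m} f = begin
  sum (map h (allV (suc (suc n)) m))
    ≡⟨ sum-allV h ⟩
  f (inj₁ (suc zero)) + sum (map (h ∘ inj₁) (tabulate u₃₊)) + sum (map (h ∘ inj₂) (allFin m))
    ≡⟨ cong₂ (λ a b → f (inj₁ (suc zero)) + a + b)
         (sum-map-zero {h = h ∘ inj₁} {xs = tabulate u₃₊} (tabulate⁺ λ _ → refl))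
         (sum-map-zero {h = h ∘ inj₂} {xs = allFin m} (All.universal (λ _ → refl) _)) ⟩
  f (inj₁ (suc zero)) + 0 + 0
    ≡⟨ trans (+-identityʳ _) (+-identityʳ _) ⟩
  f (inj₁ (suc zero)) ∎
  where
  open ≡-Reasoning
  h : Vtx (suc (suc n)) m → ℕ
  h w = if isU₂ w then f w else 0
  u₃₊ : Fin n → Fin (suc (suc n))
  u₃₊ c = suc (suc c)

sumWhere-isV : ∀ {n m} (f : Vtx n m → ℕ) → sumWhere f isV (allV n m) ≡ sum (map (f ∘ inj₂) (allFin m))
sumWhere-isV {n} {m} f = trans (sum-allV h) (cong (_+ sum (map (f ∘ inj₂) (allFin m)))
  (sum-map-zero {h = h ∘ inj₁} {xs = allFin n} (All.universal (λ _ → refl) _)))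
  where
  h : Vtx n m → ℕ
  h w = if isV w then f w else 0

triangle≤sum-distinct-positive : ∀ {m} (h : Fin m → ℕ) → (∀ {i j} → h i ≡ h j → i ≡ j) →
  triangle (suc m) ≤ sum (map (suc ∘ h) (allFin m))
triangle≤sum-distinct-positive {m} h h-injective =
  subst (λ l → triangle (suc l) ≤ sum (map (suc ∘ h) (allFin m)))
    (trans (length-map (suc ∘ h) (allFin m)) (length-tabulate {n = m} id))
    (triangle-length≤sum {0 ∷ map (suc ∘ h) (allFin m)}
      (0∉ ∷ Unique.map⁺ (h-injective ∘ suc-injective) (Unique.allFin⁺ m)))
  where
  0∉ : All (λ y → ¬ 0 ≡ y) (map (suc ∘ h) (allFin m))
  0∉ = All-map⁺ (All.universal (λ _ ()) _)

-- The magic condition of IsKDistMagicLabeling, for an arbitrary weight f.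
Constant∂N₂Sum : ∀ {n m} → VEdges m → (Vtx n m → ℕ) → ℕ → Set
Constant∂N₂Sum {n} {m} G f M =
  ∀ u → Σ (Vtx n m) (λ w → distIs G 2 u w ≡ true) → sumOver f (distIs G 2 u) ≡ M

module _ {n m} (G : VEdges (suc m)) (f : Vtx (suc (suc n)) (suc m) → ℕ) {M : ℕ}
         (constant : Constant∂N₂Sum G f M) where

  private
    V : List (Vtx (suc (suc n)) (suc m))
    V = allV (suc (suc n)) (suc m)

    u₂ : Vtx (suc (suc n)) (suc m)
    u₂ = inj₁ (suc zero)

    M-from-v : ∀ i → sumOver f (distIs G 2 (inj₂ i)) ≡ M
    M-from-v i = constant (inj₂ i) (u₂ , distIs-2-from-v {suc n} G i u₂)

    closedNbhdSum+distant+M : ∀ i → closedNbhdSum G f (inj₂ i) + sumWhere f distant V + M ≡ sum (map f V)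
    closedNbhdSum+distant+M i =
      subst (λ s → closedNbhdSum G f (inj₂ i) + sumWhere f distant V + s ≡ sum (map f V))
        (M-from-v i) (closedNbhdSum+distant+sphere₂ {suc n} G f i)

  closedNbhdSum-v-constant : ∀ i j → closedNbhdSum G f (inj₂ i) ≡ closedNbhdSum G f (inj₂ j)
  closedNbhdSum-v-constant i j = +-cancelʳ-≡ (sumWhere f distant V) _ _ (+-cancelʳ-≡ M _ _
    (trans (closedNbhdSum+distant+M i) (sym (closedNbhdSum+distant+M j))))

  sum-v≤constant : sum (map (f ∘ inj₂) (allFin (suc m))) ≤ M
  sum-v≤constant = begin
    sum (map (f ∘ inj₂) (allFin (suc m))) ≡⟨ sumWhere-isV f ⟨
    sumWhere f isV V                       ≤⟨ sumWhere-mono f {P = isV} {Q = distIs G 2 u₂} V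
                                                  (λ { (inj₂ j) _ → distIs-2-u₂-v {n} G j }) ⟩
    sumWhere f (distIs G 2 u₂) V           ≡⟨ sum-map-filter f (distIs G 2 u₂) V ⟨
    sumOver f (distIs G 2 u₂)              ≡⟨ constant u₂ (inj₂ zero , distIs-2-u₂-v {n} G zero) ⟩
    M                                      ∎
    where open ≤-Reasoning

  complete⇒constant≡u₂ : IsCompleteV G → M ≡ f u₂
  complete⇒constant≡u₂ K = begin
    M                                     ≡⟨ M-from-v zero ⟨
    sumOver f (distIs G 2 (inj₂ zero))    ≡⟨ sum-map-filter f (distIs G 2 (inj₂ zero)) V ⟩
    sumWhere f (distIs G 2 (inj₂ zero)) V ≡⟨ sumWhere-cong f V (distIs-2-from-v-complete G K zero) ⟩
    sumWhere f isU₂ V                     ≡⟨ sumWhere-isU₂ f ⟩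
    f u₂                                  ∎
    where open ≡-Reasoning

theorem3p2 : (n m : ℕ) → 2 ≤ n → 2 ≤ m → (G : VEdges m)
    → (g : Vtx n m → Fin (Data.Nat._+_ n m))
    → IsKDistMagicLabeling {n} {m} G 2 g
    → (IsCompleteV {m} G → m * (m ∸ 1) ≤ 2 * n)
      × (¬ IsCompleteV G → ∀ (i j : Fin m) → toℕ i < toℕ j
          → distIs {n} {m} G 2 (inj₂ i) (inj₂ j) ≡ true
          → closedNbhdSum {n} {m} G (label {n} g) (inj₂ i) ≡ closedNbhdSum {n} {m} G (label {n} g) (inj₂ j))
-- Part (ii) holds for all i and j.
theorem3p2 (suc (suc n)) (suc m) (s≤s (s≤s z≤n)) (s≤s _) G g (g-bijective , _ , M , constant) =
  complete⇒bound , λ _ i j _ _ → closedNbhdSum-v-constant G (label g) constant i j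
  where
  labels-v-distinct : ∀ {i j} → toℕ (g (inj₂ i)) ≡ toℕ (g (inj₂ j)) → i ≡ j
  labels-v-distinct e = inj₂-injective (proj₁ g-bijective (toℕ-injective e))

  complete⇒bound : IsCompleteV G → suc m * (suc m ∸ 1) ≤ 2 * suc (suc n)
  complete⇒bound K = subst (_≤ 2 * suc (suc n)) (2*triangle[k]≡k*[k∸1] (suc m))
    (*-monoʳ-≤ 2 (+-cancelˡ-≤ (suc m) _ _ (begin
      suc m + triangle (suc m)                    ≤⟨ triangle≤sum-distinct-positive _ labels-v-distinct ⟩
      sum (map (label g ∘ inj₂) (allFin (suc m))) ≤⟨ sum-v≤constant G (label g) constant ⟩
      M                                           ≡⟨ complete⇒constant≡u₂ G (label g) constant K ⟩
      label g (inj₁ (suc zero))                   ≤⟨ toℕ<n (g (inj₁ (suc zero))) ⟩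
      suc (suc n) + suc m                         ≡⟨ +-comm (suc (suc n)) (suc m) ⟩
      suc m + suc (suc n)                         ∎)))
    where open ≤-Reasoning
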